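{- Let $G$ be a graph with $e > 0$ edges, where $3 \mid e$. Suppose there exist $G$ designs of order $2e+1$ and $4e+1$, and suppose there exists a decomposition into $G$ of the complete tripartite graph $K_{e/3,e/3,e/3}$. Then there exists a $G$ design of order $n$ for every $n \equiv 1 \pmod{2e}$.
   Context: All graphs are simple. A decomposition of a graph $K$ into $G$ is a partition of the edge set of $K$ into edge sets of subgraphs each isomorphic to $G$; a $G$ design of order $n$ is a decomposition of the complete graph $K_n$ into $G$. By convention the empty set is a $G$ design of order $1$. -}

module Defs where

open import Data.Nat using (ℕ; zero; suc; _+_; _*_; _<ᵇ_)
open import Data.Nat.DivMod using (_%_)
open import Data.Fin using (Fin; toℕ)
open import Data.Fin.Properties using (_≟_)
open import Data.Bool using (Bool; true; false; not; _∧_; if_then_else_)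
open import Data.List using (List; map; allFin)
open import Data.Nat.ListAction using (sum)
open import Data.Product using (Σ; ∃; _×_; _,_)
open import Function.Definitions using (Injective)
open import Relation.Binary.PropositionalEquality using (_≡_)
open import Relation.Nullary.Decidable using (⌊_⌋)
import Data.Nat.Properties as ℕP

record Graph : Set where
  field
    V      : ℕ
    adj    : Fin V → Fin V → Bool
    adj-sym    : ∀ x y → adj x y ≡ adj y x
    adj-irrefl : ∀ x → adj x x ≡ false
open Graph public

edgeCount : Graph → ℕ
edgeCount G =
  sum (map (λ x → sum (map (λ y →
        if (toℕ x <ᵇ toℕ y) ∧ adj G x y then 1 else 0)
      (allFin (V G))))
    (allFin (V G)))

K : ℕ → Graph
K n = record
  { V = n
  ; adj = λ x y → not ⌊ x ≟ y ⌋
  ; adj-sym = λ x y → symK x y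
  ; adj-irrefl = λ x → irrK x
  }
  where
  open import Relation.Binary.PropositionalEquality using (refl; sym)
  open import Relation.Nullary using (yes; no)
  symK : (x y : Fin n) → not ⌊ x ≟ y ⌋ ≡ not ⌊ y ≟ x ⌋
  symK x y with x ≟ y | y ≟ x
  ... | yes _ | yes _ = refl
  ... | no _  | no _  = refl
  ... | yes p | no q  with q (sym p)
  ... | ()
  symK x y | no q | yes p with q (sym p)
  ... | ()
  irrK : (x : Fin n) → not ⌊ x ≟ x ⌋ ≡ false
  irrK x with x ≟ x
  ... | yes _ = refl
  ... | no q with q refl
  ... | ()

-- complete tripartite graph K_{t,t,t}: vertex set Fin (3 * t), where the
-- three parts are the residue classes of toℕ x modulo 3 (each of size t);
-- two vertices are adjacent iff they lie in different parts.
Tripartite : ℕ → Graph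
Tripartite t = record
  { V = 3 * t
  ; adj = λ x y → not ⌊ toℕ x % 3 ℕP.≟ toℕ y % 3 ⌋
  ; adj-sym = λ x y → symT x y
  ; adj-irrefl = λ x → irrT x
  }
  where
  open import Relation.Binary.PropositionalEquality using (refl; sym)
  open import Relation.Nullary using (yes; no)
  symT : (x y : Fin (3 * t)) →
         not ⌊ toℕ x % 3 ℕP.≟ toℕ y % 3 ⌋ ≡ not ⌊ toℕ y % 3 ℕP.≟ toℕ x % 3 ⌋
  symT x y with toℕ x % 3 ℕP.≟ toℕ y % 3 | toℕ y % 3 ℕP.≟ toℕ x % 3
  ... | yes _ | yes _ = refl
  ... | no _  | no _  = refl
  ... | yes p | no q  with q (sym p)
  ... | ()
  symT x y | no q | yes p with q (sym p)
  ... | ()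
  irrT : (x : Fin (3 * t)) → not ⌊ toℕ x % 3 ℕP.≟ toℕ x % 3 ⌋ ≡ false
  irrT x with toℕ x % 3 ℕP.≟ toℕ x % 3
  ... | yes _ = refl
  ... | no q with q refl
  ... | ()

-- A copy of G in H (a subgraph of H isomorphic to G), given by an injective
-- vertex map sending edges of G to edges of H. The subgraph is the image.
record Copy (G H : Graph) : Set where
  field
    vmap      : Fin (V G) → Fin (V H)
    injective : Injective _≡_ _≡_ vmap
    edges     : ∀ x y → adj G x y ≡ true → adj H (vmap x) (vmap y) ≡ true
open Copy public

InCopy : {G H : Graph} → Copy G H → Fin (V H) → Fin (V H) → Set
InCopy {G} c a b =
  Σ (Fin (V G)) λ x → Σ (Fin (V G)) λ y →
    (adj G x y ≡ true) × (Copy.vmap c x ≡ a) × (Copy.vmap c y ≡ b)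

-- A decomposition of H into G: a finite family of copies of G in H whose edge
-- sets partition the edge set of H (every edge of H lies in exactly one copy;
-- copies only use edges of H by definition of Copy).
Decomposition : Graph → Graph → Set
Decomposition H G =
  Σ ℕ λ m → Σ (Fin m → Copy G H) λ copies →
    (∀ a b → adj H a b ≡ true → Σ (Fin m) λ i → InCopy (copies i) a b)
    × (∀ a b i j → InCopy (copies i) a b → InCopy (copies j) a b → i ≡ j)

Design : Graph → ℕ → Set
Design G n = Decomposition (K n) G

-- Wilson's fundamental construction with a point at infinity.  Given a 3-GDD with r
-- groups of size s, inflate every point by t: each block becomes a K_{t,t,t}, which is
-- decomposed by hypothesis, and each group together with one extra point ∞ becomes a
-- K_{st+1}, filled with a design of order st + 1.  This yields a design of order
-- rst + 1.  Writing e = 3t, the orders 6tk + 1 are reached by the 3-GDDs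
--   3^k ⊗ TD(3,2) = 6^k            (k odd, fillings of order 2e + 1),
--   3^(k/2) ⊗ TD(3,4) = 12^(k/2)   (k ≡ 2 mod 4, fillings of order 4e + 1),
--   2^4 ⊗ TD(3,3p) = (6p)^4        (k = 4p, fillings of order 6tp + 1 by induction),
-- where 3^u (u = 2h + 1) has the blocks {(m - d, i), (m + d, i), (m, i + 1)} on Z_u × Z_3
-- for 1 ≤ d ≤ h, and TD(3,w) is the cyclic Latin square of order w.

module Submission where

open import Defs
open import Data.Nat using (ℕ; zero; suc; NonZero)
import Data.Nat as ℕ
import Data.Nat.Properties as ℕ
open import Data.Bool using (true)
open import Data.Empty using (⊥-elim)
open import Data.Fin using (Fin; zero; suc; toℕ; fromℕ<; cast; remQuot; combine)
open import Data.Fin.Properties using (+↔⊎; *↔×; 1↔⊤)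
import Data.Fin.Properties as Fin
open import Data.Fin.Patterns using (0F; 1F; 2F; 3F)
open import Data.Product using (Σ; _×_; _,_; proj₁; proj₂; map₂)
open import Data.Product.Algebra using (×-comm)
open import Data.Product.Function.NonDependent.Propositional using (_×-↔_)
open import Data.Sum using (_⊎_; inj₁; inj₂; [_,_])
open import Data.Sum.Properties using (inj₂-injective)
open import Data.Sum.Function.Propositional using (_⊎-↔_)
open import Data.Unit using (⊤; tt)
open import Function using (_∘_)
open import Function.Bundles using (_↔_; Inverse; mk↔ₛ′; Injection)
open import Function.Definitions using (Injective)
open import Function.Properties.Inverse using (↔-refl; ↔-sym; ↔-trans; ↔⇒↣)
open import Relation.Binary using (Setoid)
import Relation.Binary.Reasoning.Setoid
open import Relation.Nullary using (¬_; Dec; yes; no)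
open import Relation.Binary.PropositionalEquality hiding ([_])

private variable
  A B X I : Set
  G H : Graph
  n : ℕ

Finite : Set → Set
Finite A = Σ ℕ λ n → Fin n ↔ A

↔-to-injective : (e : A ↔ B) → Injective _≡_ _≡_ (Inverse.to e)
↔-to-injective e = Injection.injective (↔⇒↣ e)

↔-from-injective : (e : A ↔ B) → Injective _≡_ _≡_ (Inverse.from e)
↔-from-injective e = ↔-to-injective (↔-sym e)

∑ : (m : ℕ) → (Fin m → ℕ) → ℕ
∑ zero    c = 0
∑ (suc m) c = c zero ℕ.+ ∑ m (c ∘ suc)

Σ-Fin-suc↔ : ∀ {n} (P : Fin (suc n) → Set) → (P zero ⊎ Σ (Fin n) (P ∘ suc)) ↔ Σ (Fin (suc n)) P
Σ-Fin-suc↔ {n} P = mk↔ₛ′ to from to-from from-to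
  where
  to : P zero ⊎ Σ (Fin n) (P ∘ suc) → Σ (Fin (suc n)) P
  to (inj₁ p)       = zero , p
  to (inj₂ (i , p)) = suc i , p
  from : Σ (Fin (suc n)) P → P zero ⊎ Σ (Fin n) (P ∘ suc)
  from (zero  , p) = inj₁ p
  from (suc i , p) = inj₂ (i , p)
  to-from : ∀ x → to (from x) ≡ x
  to-from (zero  , p) = refl
  to-from (suc i , p) = refl
  from-to : ∀ x → from (to x) ≡ x
  from-to (inj₁ p)       = refl
  from-to (inj₂ (i , p)) = refl

Σ-Fin↔ : ∀ m (c : Fin m → ℕ) → Fin (∑ m c) ↔ Σ (Fin m) (Fin ∘ c)
Σ-Fin↔ zero    c = mk↔ₛ′ (λ ()) (λ ()) (λ ()) (λ ())
Σ-Fin↔ (suc m) c =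
  ↔-trans +↔⊎ (↔-trans (↔-refl ⊎-↔ Σ-Fin↔ m (c ∘ suc)) (Σ-Fin-suc↔ (Fin ∘ c)))

-- Group divisible designs with block size three

-- Points are pairs (g , a), the group of (g , a) being g.
record GDD₃ (R S : Set) : Set₁ where
  field
    Block       : Set
    finite      : Finite Block
    point       : Block → Fin 3 → R × S
    transversal : ∀ B {ρ ρ'} → ρ ≢ ρ' → proj₁ (point B ρ) ≢ proj₁ (point B ρ')
    cover       : ∀ p q → proj₁ p ≢ proj₁ q →
                  Σ Block λ B → Σ (Fin 3) λ ρ → Σ (Fin 3) λ ρ' → point B ρ ≡ p × point B ρ' ≡ q
    unique      : ∀ {B B' ρ ρ' σ σ'} → ρ ≢ ρ' →
                  point B ρ ≡ point B' σ → point B ρ' ≡ point B' σ' → B ≡ B'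

  inflate : ∀ {W : Set} → Block → Fin 3 × W → R × (S × W)
  inflate B (ρ , w) = map₂ (_, w) (point B ρ)

  inflate-injective : ∀ {W : Set} {B B'} {p q : Fin 3 × W} → inflate B p ≡ inflate B' q →
                      point B (proj₁ p) ≡ point B' (proj₁ q) × proj₂ p ≡ proj₂ q
  inflate-injective e = cong (map₂ proj₁) e , cong (proj₂ ∘ proj₂) e

  point-injective : ∀ B {ρ σ} → point B ρ ≡ point B σ → ρ ≡ σ
  point-injective B {ρ} {σ} e with ρ Fin.≟ σ
  ... | yes ρ≡σ = ρ≡σ
  ... | no  ρ≢σ = ⊥-elim (transversal B ρ≢σ (cong proj₁ e))

data Ascending : Fin 3 → Fin 3 → Set where
  0<1 : Ascending 0F 1F
  0<2 : Ascending 0F 2F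
  1<2 : Ascending 1F 2F

ascending : ∀ {ρ ρ'} → ρ ≢ ρ' → Ascending ρ ρ' ⊎ Ascending ρ' ρ
ascending {0F} {0F} ρ≢ρ' = ⊥-elim (ρ≢ρ' refl)
ascending {0F} {1F} _    = inj₁ 0<1
ascending {0F} {2F} _    = inj₁ 0<2
ascending {1F} {0F} _    = inj₂ 0<1
ascending {1F} {1F} ρ≢ρ' = ⊥-elim (ρ≢ρ' refl)
ascending {1F} {2F} _    = inj₁ 1<2
ascending {2F} {0F} _    = inj₂ 0<2
ascending {2F} {1F} _    = inj₂ 1<2
ascending {2F} {2F} ρ≢ρ' = ⊥-elim (ρ≢ρ' refl)

unique-from-ascending : ∀ {Block P : Set} (point : Block → Fin 3 → P) →
  (∀ B {ρ ρ'} → ρ ≢ ρ' → point B ρ ≢ point B ρ') →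
  (∀ {B B' ρ ρ' σ σ'} → Ascending ρ ρ' → σ ≢ σ' →
     point B ρ ≡ point B' σ → point B ρ' ≡ point B' σ' → B ≡ B') →
  ∀ {B B' ρ ρ' σ σ'} → ρ ≢ ρ' → point B ρ ≡ point B' σ → point B ρ' ≡ point B' σ' → B ≡ B'
unique-from-ascending point distinct unique {B} ρ≢ρ' e e' with ascending ρ≢ρ'
... | inj₁ asc = unique asc (λ { refl → distinct B ρ≢ρ' (trans e (sym e')) }) e e'
... | inj₂ asc = unique asc (λ { refl → distinct B ρ≢ρ' (trans e (sym e')) }) e' e

-- Wilson's fundamental construction with a TD(3, w) as ingredient: every block B of the
-- master design is replaced by a copy of the transversal design on the points of B × W.
_⊗_ : ∀ {R S W} → GDD₃ R S → GDD₃ (Fin 3) W → GDD₃ R (S × W)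
𝓜 ⊗ 𝓘 = record
  { Block       = M.Block × I.Block
  ; finite      = finite
  ; point       = λ (B , C) σ → M.inflate B (I.point C σ)
  ; transversal = λ (B , C) σ≢σ' → M.transversal B (I.transversal C σ≢σ')
  ; cover       = cover
  ; unique      = unique
  }
  where
  module M = GDD₃ 𝓜
  module I = GDD₃ 𝓘

  open M using (inflate; inflate-injective)

  finite : Finite (M.Block × I.Block)
  finite with m , M↔ ← M.finite | n , I↔ ← I.finite = m ℕ.* n , ↔-trans *↔× (M↔ ×-↔ I↔)

  cover : ∀ p q → proj₁ p ≢ proj₁ q → Σ (M.Block × I.Block) λ (B , C) →
          Σ (Fin 3) λ σ → Σ (Fin 3) λ σ' → inflate B (I.point C σ) ≡ p × inflate B (I.point C σ') ≡ q
  cover (g , a , w) (g' , a' , w') g≢g'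
    with B , ρ , ρ' , eρ , eρ' ← M.cover (g , a) (g' , a') g≢g'
    with C , σ , σ' , eσ , eσ' ← I.cover (ρ , w) (ρ' , w') (λ { refl → g≢g' (cong proj₁ (trans (sym eρ) eρ')) })
    = (B , C) , σ , σ' , trans (cong (inflate B) eσ) (cong (map₂ (_, w)) eρ)
                       , trans (cong (inflate B) eσ') (cong (map₂ (_, w')) eρ')

  unique : ∀ {BC BC' σ₁ σ₂ τ₁ τ₂} → σ₁ ≢ σ₂ →
           inflate (proj₁ BC) (I.point (proj₂ BC) σ₁) ≡ inflate (proj₁ BC') (I.point (proj₂ BC') τ₁) →
           inflate (proj₁ BC) (I.point (proj₂ BC) σ₂) ≡ inflate (proj₁ BC') (I.point (proj₂ BC') τ₂) →
           BC ≡ BC'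
  unique {B , C} {B' , C'} σ₁≢σ₂ e₁ e₂
    with eM₁ , ew₁ ← inflate-injective {B = B} {B'} e₁ | eM₂ , ew₂ ← inflate-injective {B = B} {B'} e₂
    with refl ← M.unique (I.transversal C σ₁≢σ₂) eM₁ eM₂
    = cong (B ,_) (I.unique σ₁≢σ₂ (cong₂ _,_ (M.point-injective B eM₁) ew₁)
                                  (cong₂ _,_ (M.point-injective B eM₂) ew₂))

module Residues (k : ℕ) .{{_ : NonZero k}} where
  open import Data.Integer using (ℤ; +_; -_; _+_; _-_; _*_; 0ℤ; 1ℤ; ∣_∣; _%ℕ_; _/ℕ_; _⊖_)
  import Data.Integer.Properties as ℤ
  open import Data.Integer.DivMod using (n%ℕd<d; a≡a%ℕn+[a/ℕn]*n)
  open import Data.Integer.Divisibility.Signed using (_∣_; divides; ∣m∣n⇒∣m+n; ∣m⇒∣-m; ∣⇒∣ᵤ; ∣n⇒∣m*n)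
  open import Data.Integer.Tactic.RingSolver using (solve-∀)
  open import Data.Nat.Divisibility as ℕ using (∣⇒≤)

  infix 4 _≈_
  record _≈_ (a b : ℤ) : Set where
    constructor mod
    field divides-difference : + k ∣ a - b

  private
    by : ∀ {x a b} → x ≡ a - b → + k ∣ x → a ≈ b
    by eq p = mod (subst (+ k ∣_) eq p)

  ≈-reflexive : ∀ {a b} → a ≡ b → a ≈ b
  ≈-reflexive {a} refl = mod (divides 0ℤ (ℤ.+-inverseʳ a))

  ≈-refl : ∀ {a} → a ≈ a
  ≈-refl = ≈-reflexive refl

  ≈-sym : ∀ {a b} → a ≈ b → b ≈ a
  ≈-sym {a} {b} (mod p) = by (lemma a b) (∣m⇒∣-m p)
    where lemma : ∀ a b → - (a - b) ≡ b - a
          lemma = solve-∀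

  ≈-trans : ∀ {a b c} → a ≈ b → b ≈ c → a ≈ c
  ≈-trans {a} {b} {c} (mod p) (mod q) = by (lemma a b c) (∣m∣n⇒∣m+n p q)
    where lemma : ∀ a b c → (a - b) + (b - c) ≡ a - c
          lemma = solve-∀

  ≈-setoid : Setoid _ _
  ≈-setoid = record { Carrier = ℤ ; _≈_ = _≈_
    ; isEquivalence = record
      { refl  = λ {a} → ≈-reflexive {a} refl
      ; sym   = λ {a} {b} → ≈-sym {a} {b}
      ; trans = λ {a} {b} {c} → ≈-trans {a} {b} {c} } }

  module ≈-Reasoning = Relation.Binary.Reasoning.Setoid ≈-setoid

  +-≈ : ∀ {a a' b b'} → a ≈ a' → b ≈ b' → a + b ≈ a' + b'
  +-≈ {a} {a'} {b} {b'} (mod p) (mod q) = by (lemma a a' b b') (∣m∣n⇒∣m+n p q)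
    where lemma : ∀ a a' b b' → (a - a') + (b - b') ≡ (a + b) - (a' + b')
          lemma = solve-∀

  +-cancelˡ-≈ : ∀ {a a' b b'} → a ≈ a' → a + b ≈ a' + b' → b ≈ b'
  +-cancelˡ-≈ {a} {a'} {b} {b'} (mod p) (mod q) = by (lemma a a' b b') (∣m∣n⇒∣m+n q (∣m⇒∣-m p))
    where lemma : ∀ a a' b b' → ((a + b) - (a' + b')) + - (a - a') ≡ b - b'
          lemma = solve-∀

  +-cancelʳ-≈ : ∀ {a a' b b'} → b ≈ b' → a + b ≈ a' + b' → a ≈ a'
  +-cancelʳ-≈ {a} {a'} {b} {b'} (mod p) (mod q) = by (lemma a a' b b') (∣m∣n⇒∣m+n q (∣m⇒∣-m p))
    where lemma : ∀ a a' b b' → ((a + b) - (a' + b')) + - (b - b') ≡ a - a'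
          lemma = solve-∀

  ≈⇒-≈0 : ∀ {a b} → a ≈ b → a - b ≈ 0ℤ
  ≈⇒-≈0 {a} {b} (mod p) = by (sym (ℤ.+-identityʳ (a - b))) p

  ≈-cancel-0 : ∀ a a' → a + 0ℤ ≈ a' + 0ℤ → a ≈ a'
  ≈-cancel-0 a a' = subst₂ _≈_ (ℤ.+-identityʳ a) (ℤ.+-identityʳ a')

  ≈-shift : ∀ a b {c} → a - b ≈ c → a ≈ b + c
  ≈-shift a b {c} p = begin
    a                      ≡⟨ lemma a b c ⟩
    (b + c) + ((a - b) - c) ≈⟨ +-≈ (≈-refl {b + c}) (≈⇒-≈0 p) ⟩
    (b + c) + 0ℤ           ≡⟨ ℤ.+-identityʳ (b + c) ⟩
    b + c                  ∎
    where
    open ≈-Reasoning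
    lemma : ∀ a b c → a ≡ (b + c) + ((a - b) - c)
    lemma = solve-∀

  complement : ∀ {m} → m ℕ.≤ k → + m ≈ - + (k ℕ.∸ m)
  complement {m} m≤k = mod (divides 1ℤ (begin
    + m - - + (k ℕ.∸ m)      ≡⟨ cong (λ x → + m + x) (ℤ.neg-involutive (+ (k ℕ.∸ m))) ⟩
    + m + + (k ℕ.∸ m)        ≡⟨ ℤ.pos-+ m _ ⟨
    + (m ℕ.+ (k ℕ.∸ m))      ≡⟨ cong +_ (ℕ.m+[n∸m]≡n m≤k) ⟩
    + k                      ≡⟨ ℤ.*-identityˡ (+ k) ⟨
    1ℤ * + k                 ∎))
    where open ≡-Reasoning

  -‿≈ : ∀ {a b} → a ≈ b → - a ≈ - b
  -‿≈ {a} {b} (mod p) = by (lemma a b) (∣m⇒∣-m p)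
    where lemma : ∀ a b → - (a - b) ≡ - a - - b
          lemma = solve-∀

  *-≈ : ∀ c {a b} → a ≈ b → c * a ≈ c * b
  *-≈ c {a} {b} (mod p) = by (lemma c a b) (∣n⇒∣m*n c p)
    where lemma : ∀ c a b → c * (a - b) ≡ c * a - c * b
          lemma = solve-∀

  ≈-small : ∀ {m n} → m ℕ.< k → n ℕ.< k → + m ≈ + n → m ≡ n
  ≈-small {m} {n} m<k n<k (mod p) with ∣ m ⊖ n ∣ in eq
  ... | zero  =
    ℤ.+-injective (ℤ.i-j≡0⇒i≡j (+ m) (+ n) (ℤ.∣i∣≡0⇒i≡0 (trans (cong ∣_∣ (ℤ.m-n≡m⊖n m n)) eq)))
  ... | suc d = ⊥-elim (ℕ.<⇒≱ d<k (∣⇒≤ k∣d))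
    where
    k∣d : k ℕ.∣ suc d
    k∣d = subst (k ℕ.∣_) (trans (cong ∣_∣ (ℤ.m-n≡m⊖n m n)) eq) (∣⇒∣ᵤ p)
    d<k : suc d ℕ.< k
    d<k = subst (ℕ._< k) eq (ℕ.≤-<-trans (ℤ.∣m⊝n∣≤m⊔n m n) (ℕ.⊔-lub m<k n<k))

  -- Opaque, so that terms such as ⟦ x ⟧ + a stay neutral and implicit arguments
  -- of the congruence lemmas remain inferable.
  opaque
    [_] : ℤ → Fin k
    [ a ] = fromℕ< (n%ℕd<d a k)

    ⟦_⟧ : Fin k → ℤ
    ⟦ x ⟧ = + toℕ x

    ⟦⟧≡ : ∀ x → ⟦ x ⟧ ≡ + toℕ x
    ⟦⟧≡ x = refl

    ⟦[]⟧≈ : ∀ a → ⟦ [ a ] ⟧ ≈ a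
    ⟦[]⟧≈ a = mod (divides (- (a /ℕ k)) (begin
      ⟦ [ a ] ⟧ - a                              ≡⟨ cong (λ r → + r - a) (Fin.toℕ-fromℕ< _) ⟩
      + (a %ℕ k) - a                             ≡⟨ cong (λ b → + (a %ℕ k) - b) (a≡a%ℕn+[a/ℕn]*n a k) ⟩
      + (a %ℕ k) - (+ (a %ℕ k) + a /ℕ k * + k)   ≡⟨ lemma (+ (a %ℕ k)) (a /ℕ k) (+ k) ⟩
      - (a /ℕ k) * + k                           ∎))
      where
      open ≡-Reasoning
      lemma : ∀ r q k → r - (r + q * k) ≡ - q * k
      lemma = solve-∀

  ⟦⟧-injective : ∀ {x y} → ⟦ x ⟧ ≈ ⟦ y ⟧ → x ≡ y
  ⟦⟧-injective {x} {y} p =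
    Fin.toℕ-injective (≈-small (Fin.toℕ<n x) (Fin.toℕ<n y) (subst₂ _≈_ (⟦⟧≡ x) (⟦⟧≡ y) p))

  []-cong : ∀ {a b} → a ≈ b → [ a ] ≡ [ b ]
  []-cong {a} {b} p = ⟦⟧-injective (≈-trans (⟦[]⟧≈ a) (≈-trans p (≈-sym (⟦[]⟧≈ b))))

  []-injective : ∀ {a b} → [ a ] ≡ [ b ] → a ≈ b
  []-injective {a} {b} p = ≈-trans (≈-sym (⟦[]⟧≈ a)) (≈-trans (≈-reflexive (cong ⟦_⟧ p)) (⟦[]⟧≈ b))

  [⟦⟧] : ∀ x → [ ⟦ x ⟧ ] ≡ x
  [⟦⟧] x = ⟦⟧-injective (⟦[]⟧≈ ⟦ x ⟧)

  []≡ : ∀ {a x} → a ≈ ⟦ x ⟧ → [ a ] ≡ x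
  []≡ {x = x} p = trans ([]-cong p) ([⟦⟧] x)

-- The cyclic transversal design TD(3, w)

module _ (w : ℕ) .{{_ : NonZero w}} where
  open import Data.Integer using (_+_; _-_)
  open import Data.Integer.Tactic.RingSolver using (solve-∀)
  open Residues w

  private
    Block : Set
    Block = Fin w × Fin w

    coordinate : Block → Fin 3 → Fin w
    coordinate (u , v) 0F = u
    coordinate (u , v) 1F = v
    coordinate (u , v) 2F = [ ⟦ u ⟧ + ⟦ v ⟧ ]

    point : Block → Fin 3 → Fin 3 × Fin w
    point B ρ = ρ , coordinate B ρ

    add-sub : ∀ x y → [ ⟦ x ⟧ + ⟦ [ ⟦ y ⟧ - ⟦ x ⟧ ] ⟧ ] ≡ y
    add-sub x y =
      []≡ (≈-trans (+-≈ (≈-refl {⟦ x ⟧}) (⟦[]⟧≈ (⟦ y ⟧ - ⟦ x ⟧))) (≈-reflexive (lemma ⟦ x ⟧ ⟦ y ⟧)))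
      where lemma : ∀ x y → x + (y - x) ≡ y
            lemma = solve-∀

    sub-add : ∀ x y → [ ⟦ [ ⟦ y ⟧ - ⟦ x ⟧ ] ⟧ + ⟦ x ⟧ ] ≡ y
    sub-add x y =
      []≡ (≈-trans (+-≈ (⟦[]⟧≈ (⟦ y ⟧ - ⟦ x ⟧)) (≈-refl {⟦ x ⟧})) (≈-reflexive (lemma ⟦ x ⟧ ⟦ y ⟧)))
      where lemma : ∀ x y → (y - x) + x ≡ y
            lemma = solve-∀

    cover : ∀ p q → proj₁ p ≢ proj₁ q →
            Σ Block λ B → Σ (Fin 3) λ ρ → Σ (Fin 3) λ ρ' → point B ρ ≡ p × point B ρ' ≡ q
    cover (0F , a) (0F , a') ne = ⊥-elim (ne refl)
    cover (0F , a) (1F , a') _  = (a , a') , 0F , 1F , refl , refl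
    cover (0F , a) (2F , a') _  = (a , [ ⟦ a' ⟧ - ⟦ a ⟧ ]) , 0F , 2F , refl , cong (2F ,_) (add-sub a a')
    cover (1F , a) (0F , a') _  = (a' , a) , 1F , 0F , refl , refl
    cover (1F , a) (1F , a') ne = ⊥-elim (ne refl)
    cover (1F , a) (2F , a') _  = ([ ⟦ a' ⟧ - ⟦ a ⟧ ] , a) , 1F , 2F , refl , cong (2F ,_) (sub-add a a')
    cover (2F , a) (0F , a') _  = (a' , [ ⟦ a ⟧ - ⟦ a' ⟧ ]) , 2F , 0F , cong (2F ,_) (add-sub a' a) , refl
    cover (2F , a) (1F , a') _  = ([ ⟦ a ⟧ - ⟦ a' ⟧ ] , a') , 2F , 1F , cong (2F ,_) (sub-add a' a) , refl
    cover (2F , a) (2F , a') ne = ⊥-elim (ne refl)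

    unique : ∀ {B B' ρ ρ' σ σ'} → Ascending ρ ρ' → σ ≢ σ' →
             point B ρ ≡ point B' σ → point B ρ' ≡ point B' σ' → B ≡ B'
    unique {u , v} {u' , v'} 0<1 _ refl refl = refl
    unique {u , v} {u' , v'} 0<2 _ refl e₂ with refl ← cong proj₁ e₂ =
      cong (u ,_) (⟦⟧-injective (+-cancelˡ-≈ (≈-refl {⟦ u ⟧}) ([]-injective (cong proj₂ e₂))))
    unique {u , v} {u' , v'} 1<2 _ refl e₂ with refl ← cong proj₁ e₂ =
      cong (_, v) (⟦⟧-injective (+-cancelʳ-≈ {⟦ u ⟧} {⟦ u' ⟧} ≈-refl ([]-injective (cong proj₂ e₂))))

  cyclic-TD : GDD₃ (Fin 3) (Fin w)
  cyclic-TD = record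
    { Block       = Block
    ; finite      = w ℕ.* w , *↔×
    ; point       = point
    ; transversal = λ _ ρ≢ρ' → ρ≢ρ'
    ; cover       = cover
    ; unique      = unique-from-ascending point (λ _ ρ≢ρ' → ρ≢ρ' ∘ cong proj₁) unique
    }

module OddResidues (h : ℕ) where
  open import Data.Integer using (ℤ; +_; -_; _+_; _-_; _*_; 0ℤ; 1ℤ)
  import Data.Integer.Properties as ℤ
  open import Data.Integer.Divisibility.Signed using (divides)
  open import Data.Integer.Tactic.RingSolver using (solve-∀)

  k : ℕ
  k = suc (h ℕ.+ h)

  open Residues k public

  radius : Fin h → ℕ
  radius c = suc (toℕ c)

  radius⁻¹ : ∀ {m} → 0 ℕ.< m → m ℕ.≤ h → Σ (Fin h) λ c → radius c ≡ m
  radius⁻¹ {suc m} _ m<h = fromℕ< m<h , cong suc (Fin.toℕ-fromℕ< m<h)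

  radius<k : ∀ c → radius c ℕ.< k
  radius<k c = ℕ.s≤s (ℕ.≤-trans (Fin.toℕ<n c) (ℕ.m≤m+n h h))

  radius-injective : ∀ c c' → + radius c ≈ + radius c' → c ≡ c'
  radius-injective c c' p = Fin.toℕ-injective (ℕ.suc-injective (≈-small (radius<k c) (radius<k c') p))

  radius-≉0 : ∀ c → ¬ (+ radius c ≈ 0ℤ)
  radius-≉0 c p = ℕ.1+n≢0 (≈-small (radius<k c) (ℕ.s≤s ℕ.z≤n) p)

  radius-≉-radius : ∀ c c' → ¬ (+ radius c ≈ - + radius c')
  radius-≉-radius c c' p = ℕ.1+n≢0 (≈-small sum<k (ℕ.s≤s ℕ.z≤n) (subst₂ _≈_ sum refl (≈⇒-≈0 p)))
    where
    sum : + radius c - - + radius c' ≡ + (radius c ℕ.+ radius c')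
    sum = trans (cong (λ x → + radius c + x) (ℤ.neg-involutive (+ radius c'))) (sym (ℤ.pos-+ (radius c) (radius c')))
    sum<k : radius c ℕ.+ radius c' ℕ.< k
    sum<k = ℕ.s≤s (ℕ.+-mono-≤ (Fin.toℕ<n c) (Fin.toℕ<n c'))

  twice-half : ∀ a → + suc h * (a + a) ≈ a
  twice-half a = mod (divides a (begin
    + suc h * (a + a) - a                  ≡⟨ cong (λ x → x * (a + a) - a) (ℤ.pos-+ 1 h) ⟩
    (1ℤ + + h) * (a + a) - a               ≡⟨ lemma a (+ h) ⟩
    a * (1ℤ + (+ h + + h))                 ≡⟨ cong (λ x → a * (1ℤ + x)) (ℤ.pos-+ h h) ⟨
    a * (1ℤ + + (h ℕ.+ h))                 ≡⟨ cong (a *_) (ℤ.pos-+ 1 (h ℕ.+ h)) ⟨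
    a * + k                                ∎))
    where
    open ≡-Reasoning
    lemma : ∀ a x → (1ℤ + x) * (a + a) - a ≡ a * (1ℤ + (x + x))
    lemma = solve-∀

  ≈-half : ∀ {a b} → a + a ≈ b + b → a ≈ b
  ≈-half {a} {b} p = begin
    a                  ≈⟨ twice-half a ⟨
    + suc h * (a + a)  ≈⟨ *-≈ (+ suc h) p ⟩
    + suc h * (b + b)  ≈⟨ twice-half b ⟩
    b                  ∎
    where open ≈-Reasoning

  ±radius : ∀ {a} → ¬ (a ≈ 0ℤ) → Σ (Fin h) λ c → a ≈ + radius c ⊎ a ≈ - + radius c
  ±radius {a} a≉0 = from-representative (Fin.toℕ<n [ a ]) (subst (_≈ a) (⟦⟧≡ [ a ]) (⟦[]⟧≈ a))
    where
    from-representative : ∀ {n} → n ℕ.< k → + n ≈ a → Σ (Fin h) λ c → a ≈ + radius c ⊎ a ≈ - + radius c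
    from-representative {zero} _ 0≈a = ⊥-elim (a≉0 (≈-sym 0≈a))
    from-representative {suc n} n<k n≈a with suc n ℕ.≤? h
    ... | yes n≤h = let c , eq = radius⁻¹ (ℕ.s≤s ℕ.z≤n) n≤h in
                    c , inj₁ (≈-trans (≈-sym n≈a) (≈-reflexive (cong +_ (sym eq))))
    ... | no  n≰h = let c , eq = radius⁻¹ (ℕ.m<n⇒0<n∸m n<k) k∸n≤h in
                    c , inj₂ (≈-trans (≈-sym n≈a)
                                      (subst (λ m → + suc n ≈ - + m) (sym eq) (complement (ℕ.<⇒≤ n<k))))
      where
      k∸n≤h : k ℕ.∸ suc n ℕ.≤ h
      k∸n≤h = ℕ.+-cancelˡ-≤ (suc n) _ _ (subst (ℕ._≤ suc n ℕ.+ h) (sym (ℕ.m+[n∸m]≡n (ℕ.<⇒≤ n<k)))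
                                                (ℕ.+-monoˡ-≤ h (ℕ.≰⇒> n≰h)))

  ±twice-radius : ∀ {a} → ¬ (a ≈ 0ℤ) →
    Σ (Fin h) λ c → a ≈ + radius c + + radius c ⊎ a ≈ - + radius c + - + radius c
  ±twice-radius {a} a≉0 = twice (±radius b≉0)
    where
    b : ℤ
    b = + suc h * a
    a≈b+b : a ≈ b + b
    a≈b+b = ≈-trans (≈-sym (twice-half a)) (≈-reflexive (ℤ.*-distribˡ-+ (+ suc h) a a))
    b≉0 : ¬ (b ≈ 0ℤ)
    b≉0 b≈0 = a≉0 (≈-trans a≈b+b (+-≈ b≈0 b≈0))
    twice : (Σ (Fin h) λ c → b ≈ + radius c ⊎ b ≈ - + radius c) →
            Σ (Fin h) λ c → a ≈ + radius c + + radius c ⊎ a ≈ - + radius c + - + radius c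
    twice (c , inj₁ p) = c , inj₁ (≈-trans a≈b+b (+-≈ p p))
    twice (c , inj₂ p) = c , inj₂ (≈-trans a≈b+b (+-≈ p p))

  ≈-midpoint : ∀ a a' {b b'} → a + b ≈ a' + b' → a + - b ≈ a' + - b' → a ≈ a'
  ≈-midpoint a a' {b} {b'} p q = ≈-half (begin
    a + a                  ≡⟨ lemma a b ⟩
    (a + b) + (a + - b)    ≈⟨ +-≈ p q ⟩
    (a' + b') + (a' + - b') ≡⟨ lemma a' b' ⟨
    a' + a'                ∎)
    where
    open ≈-Reasoning
    lemma : ∀ a b → a + a ≡ (a + b) + (a + - b)
    lemma = solve-∀

-- The 3-GDD of type 3^(2h+1)

module _ (h : ℕ) where
  open import Data.Integer using (ℤ; +_; -_; _+_; _-_; 0ℤ)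
  import Data.Integer.Properties as ℤ
  open import Data.Integer.Tactic.RingSolver using (solve-∀)
  open OddResidues h

  private
    next : Fin 3 → Fin 3
    next 0F = 1F
    next 1F = 2F
    next 2F = 0F

    next-≢ : ∀ i → next i ≢ i
    next-≢ 0F ()
    next-≢ 1F ()
    next-≢ 2F ()

    next-next-≢ : ∀ i → next (next i) ≢ i
    next-next-≢ 0F ()
    next-next-≢ 1F ()
    next-next-≢ 2F ()

    data LevelRelation : Fin 3 → Fin 3 → Set where
      same  : ∀ {l} → LevelRelation l l
      below : ∀ {l} → LevelRelation l (next l)
      above : ∀ {l} → LevelRelation (next l) l

    level-relation : ∀ l l' → LevelRelation l l'
    level-relation 0F 0F = same
    level-relation 0F 1F = below
    level-relation 0F 2F = above
    level-relation 1F 0F = above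
    level-relation 1F 1F = same
    level-relation 1F 2F = below
    level-relation 2F 0F = below
    level-relation 2F 1F = above
    level-relation 2F 2F = same

    -- Block (i , m , c) is {(m - D , i), (m + D , i), (m , i + 1)} with radius D = c + 1.
    Block : Set
    Block = Fin 3 × Fin k × Fin h

    offset : Fin 3 → ℕ → ℤ
    offset 0F D = - + D
    offset 1F D = + D
    offset 2F D = 0ℤ

    level : Fin 3 → Fin 3 → Fin 3
    level i 0F = i
    level i 1F = i
    level i 2F = next i

    point : Block → Fin 3 → Fin k × Fin 3
    point (i , m , c) ρ = [ ⟦ m ⟧ + offset ρ (radius c) ] , level i ρ

    offsets-differ : ∀ {ρ ρ'} c → ρ ≢ ρ' → ¬ (offset ρ (radius c) ≈ offset ρ' (radius c))
    offsets-differ {0F} {0F} c ρ≢ρ' = ⊥-elim (ρ≢ρ' refl)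
    offsets-differ {0F} {1F} c _ p  = radius-≉-radius c c (≈-sym p)
    offsets-differ {0F} {2F} c _ p  = radius-≉0 c (-‿≈ p)
    offsets-differ {1F} {0F} c _ p  = radius-≉-radius c c p
    offsets-differ {1F} {1F} c ρ≢ρ' = ⊥-elim (ρ≢ρ' refl)
    offsets-differ {1F} {2F} c _ p  = radius-≉0 c p
    offsets-differ {2F} {0F} c _ p  = radius-≉0 c (-‿≈ (≈-sym p))
    offsets-differ {2F} {1F} c _ p  = radius-≉0 c (≈-sym p)
    offsets-differ {2F} {2F} c ρ≢ρ' = ⊥-elim (ρ≢ρ' refl)

    transversal : ∀ B {ρ ρ'} → ρ ≢ ρ' → proj₁ (point B ρ) ≢ proj₁ (point B ρ')
    transversal (i , m , c) ρ≢ρ' e = offsets-differ c ρ≢ρ' (+-cancelˡ-≈ (≈-refl {⟦ m ⟧}) ([]-injective e))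

    Through : Fin k × Fin 3 → Fin k × Fin 3 → Set
    Through p q = Σ Block λ B → Σ (Fin 3) λ ρ → Σ (Fin 3) λ ρ' → point B ρ ≡ p × point B ρ' ≡ q

    swap : ∀ {p q} → Through p q → Through q p
    swap (B , ρ , ρ' , e , e') = B , ρ' , ρ , e' , e

    difference≉0 : ∀ {y₁ y₂} → y₁ ≢ y₂ → ¬ (⟦ y₂ ⟧ - ⟦ y₁ ⟧ ≈ 0ℤ)
    difference≉0 {y₁} {y₂} y₁≢y₂ p =
      y₁≢y₂ (⟦⟧-injective (≈-sym (≈-trans (≈-shift ⟦ y₂ ⟧ ⟦ y₁ ⟧ p)
                                          (≈-reflexive (ℤ.+-identityʳ ⟦ y₁ ⟧)))))

    base-cover⁺ : ∀ l {y₁ y₂} c → ⟦ y₂ ⟧ - ⟦ y₁ ⟧ ≈ + radius c + + radius c →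
                  point (l , [ ⟦ y₁ ⟧ + + radius c ] , c) 0F ≡ (y₁ , l) ×
                  point (l , [ ⟦ y₁ ⟧ + + radius c ] , c) 1F ≡ (y₂ , l)
    base-cover⁺ l {y₁} {y₂} c p = cong (_, l) ([]≡ left) , cong (_, l) ([]≡ right)
      where
      D : ℤ
      D = + radius c
      open ≈-Reasoning
      left : ⟦ [ ⟦ y₁ ⟧ + D ] ⟧ + - D ≈ ⟦ y₁ ⟧
      left = begin
        ⟦ [ ⟦ y₁ ⟧ + D ] ⟧ + - D   ≈⟨ +-≈ (⟦[]⟧≈ (⟦ y₁ ⟧ + D)) (≈-refl { - D}) ⟩
        (⟦ y₁ ⟧ + D) + - D        ≡⟨ lemma ⟦ y₁ ⟧ D ⟩
        ⟦ y₁ ⟧                    ∎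
        where lemma : ∀ y d → (y + d) + - d ≡ y
              lemma = solve-∀
      right : ⟦ [ ⟦ y₁ ⟧ + D ] ⟧ + D ≈ ⟦ y₂ ⟧
      right = begin
        ⟦ [ ⟦ y₁ ⟧ + D ] ⟧ + D     ≈⟨ +-≈ (⟦[]⟧≈ (⟦ y₁ ⟧ + D)) (≈-refl {D}) ⟩
        (⟦ y₁ ⟧ + D) + D          ≡⟨ lemma ⟦ y₁ ⟧ D ⟩
        ⟦ y₁ ⟧ + (D + D)          ≈⟨ ≈-shift ⟦ y₂ ⟧ ⟦ y₁ ⟧ p ⟨
        ⟦ y₂ ⟧                    ∎
        where lemma : ∀ y d → (y + d) + d ≡ y + (d + d)
              lemma = solve-∀

    base-cover : ∀ l {y₁ y₂} → y₁ ≢ y₂ → Through (y₁ , l) (y₂ , l)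
    base-cover l {y₁} {y₂} y₁≢y₂ = through (±twice-radius (difference≉0 y₁≢y₂))
      where
      through : (Σ (Fin h) λ c → ⟦ y₂ ⟧ - ⟦ y₁ ⟧ ≈ + radius c + + radius c
                                ⊎ ⟦ y₂ ⟧ - ⟦ y₁ ⟧ ≈ - + radius c + - + radius c) →
                Through (y₁ , l) (y₂ , l)
      through (c , inj₁ p) = (l , [ ⟦ y₁ ⟧ + + radius c ] , c) , 0F , 1F , base-cover⁺ l c p
      through (c , inj₂ p) = swap ((l , [ ⟦ y₂ ⟧ + + radius c ] , c) , 0F , 1F , base-cover⁺ l c (begin
        ⟦ y₁ ⟧ - ⟦ y₂ ⟧        ≡⟨ lemma ⟦ y₁ ⟧ ⟦ y₂ ⟧ ⟩
        - (⟦ y₂ ⟧ - ⟦ y₁ ⟧)    ≈⟨ -‿≈ p ⟩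
        - (- D + - D)          ≡⟨ lemma′ D ⟩
        D + D                  ∎))
        where
        open ≈-Reasoning
        D : ℤ
        D = + radius c
        lemma : ∀ a b → a - b ≡ - (b - a)
        lemma = solve-∀
        lemma′ : ∀ d → - (- d + - d) ≡ d + d
        lemma′ = solve-∀

    apex-base : ∀ {y₁ y₂} (o : ℤ) → ⟦ y₂ ⟧ - ⟦ y₁ ⟧ ≈ - o → [ ⟦ y₂ ⟧ + o ] ≡ y₁
    apex-base {y₁} {y₂} o p = []≡ (begin
      ⟦ y₂ ⟧ + o               ≈⟨ +-≈ (≈-shift ⟦ y₂ ⟧ ⟦ y₁ ⟧ p) (≈-refl {o}) ⟩
      (⟦ y₁ ⟧ + - o) + o       ≡⟨ lemma ⟦ y₁ ⟧ o ⟩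
      ⟦ y₁ ⟧                   ∎)
      where
      open ≈-Reasoning
      lemma : ∀ y o → (y + - o) + o ≡ y
      lemma = solve-∀

    apex : ∀ y → [ ⟦ y ⟧ + 0ℤ ] ≡ y
    apex y = []≡ (≈-reflexive (ℤ.+-identityʳ ⟦ y ⟧))

    apex-cover : ∀ l {y₁ y₂} → y₁ ≢ y₂ → Through (y₁ , l) (y₂ , next l)
    apex-cover l {y₁} {y₂} y₁≢y₂ = through (±radius (difference≉0 y₁≢y₂))
      where
      through : (Σ (Fin h) λ c → ⟦ y₂ ⟧ - ⟦ y₁ ⟧ ≈ + radius c ⊎ ⟦ y₂ ⟧ - ⟦ y₁ ⟧ ≈ - + radius c) →
                Through (y₁ , l) (y₂ , next l)
      through (c , inj₁ p) = (l , y₂ , c) , 0F , 2F , cong (_, l) (apex-base _ p) , cong (_, next l) (apex y₂)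
      through (c , inj₂ p) = (l , y₂ , c) , 1F , 2F , cong (_, l) (apex-base _ p) , cong (_, next l) (apex y₂)

    cover : ∀ p q → proj₁ p ≢ proj₁ q → Through p q
    cover (y₁ , l₁) (y₂ , l₂) y₁≢y₂ with level-relation l₁ l₂
    ... | same  = base-cover l₁ y₁≢y₂
    ... | below = apex-cover l₁ y₁≢y₂
    ... | above = swap (apex-cover l₂ (y₁≢y₂ ∘ sym))

    same-block : ∀ {i i' m m'} c c' → i ≡ i' → ⟦ m ⟧ ≈ ⟦ m' ⟧ → + radius c ≈ + radius c' →
                 _≡_ {A = Block} (i , m , c) (i' , m' , c')
    same-block c c' refl m≈m' c≈c' = cong₂ (λ m c → _ , m , c) (⟦⟧-injective m≈m') (radius-injective c c' c≈c')

    block-determined : ∀ {i i'} m m' c c' {ρ ρ' σ σ'} → Ascending ρ ρ' → σ ≢ σ' →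
      ⟦ m ⟧ + offset ρ  (radius c) ≈ ⟦ m' ⟧ + offset σ  (radius c') → level i ρ  ≡ level i' σ  →
      ⟦ m ⟧ + offset ρ' (radius c) ≈ ⟦ m' ⟧ + offset σ' (radius c') → level i ρ' ≡ level i' σ' →
      _≡_ {A = Block} (i , m , c) (i' , m' , c')
    block-determined _ _ _ _ {σ = 0F} {0F} _ σ≢σ' _ _ _ _ = ⊥-elim (σ≢σ' refl)
    block-determined _ _ _ _ {σ = 1F} {1F} _ σ≢σ' _ _ _ _ = ⊥-elim (σ≢σ' refl)
    block-determined _ _ _ _ {σ = 2F} {2F} _ σ≢σ' _ _ _ _ = ⊥-elim (σ≢σ' refl)
    block-determined m m' c c' {σ = 0F} {1F} 0<1 _ g₁ l₁ g₂ _ =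
      let m≈m' = ≈-midpoint ⟦ m ⟧ ⟦ m' ⟧ g₂ g₁ in same-block c c' l₁ m≈m' (+-cancelˡ-≈ m≈m' g₂)
    block-determined m m' c c' {σ = 1F} {0F} 0<1 _ g₁ _ g₂ _ =
      ⊥-elim (radius-≉-radius c c' (+-cancelˡ-≈ (≈-midpoint ⟦ m ⟧ ⟦ m' ⟧ g₂ g₁) g₂))
    block-determined m m' c c' {σ = 0F} {2F} 0<2 _ g₁ l₁ g₂ _ =
      let m≈m' = ≈-cancel-0 ⟦ m ⟧ ⟦ m' ⟧ g₂ in same-block c c' l₁ m≈m' (-‿≈ (+-cancelˡ-≈ m≈m' g₁))
    block-determined m m' c c' {σ = 1F} {2F} 0<2 _ g₁ _ g₂ _ =
      ⊥-elim (radius-≉-radius c c' (-‿≈ (+-cancelˡ-≈ (≈-cancel-0 ⟦ m ⟧ ⟦ m' ⟧ g₂) g₁)))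
    block-determined m m' c c' {σ = 1F} {2F} 1<2 _ g₁ l₁ g₂ _ =
      let m≈m' = ≈-cancel-0 ⟦ m ⟧ ⟦ m' ⟧ g₂ in same-block c c' l₁ m≈m' (+-cancelˡ-≈ m≈m' g₁)
    block-determined m m' c c' {σ = 0F} {2F} 1<2 _ g₁ _ g₂ _ =
      ⊥-elim (radius-≉-radius c c' (+-cancelˡ-≈ (≈-cancel-0 ⟦ m ⟧ ⟦ m' ⟧ g₂) g₁))
    block-determined {i' = i'} _ _ _ _ {σ = 0F} {2F} 0<1 _ _ l₁ _ l₂ = ⊥-elim (next-≢ i' (trans (sym l₂) l₁))
    block-determined {i' = i'} _ _ _ _ {σ = 1F} {2F} 0<1 _ _ l₁ _ l₂ = ⊥-elim (next-≢ i' (trans (sym l₂) l₁))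
    block-determined {i' = i'} _ _ _ _ {σ = 2F} {0F} 0<1 _ _ l₁ _ l₂ = ⊥-elim (next-≢ i' (trans (sym l₁) l₂))
    block-determined {i' = i'} _ _ _ _ {σ = 2F} {1F} 0<1 _ _ l₁ _ l₂ = ⊥-elim (next-≢ i' (trans (sym l₁) l₂))
    block-determined {i} _ _ _ _ {σ = 0F} {1F} 0<2 _ _ l₁ _ l₂ = ⊥-elim (next-≢ i (trans l₂ (sym l₁)))
    block-determined {i} _ _ _ _ {σ = 1F} {0F} 0<2 _ _ l₁ _ l₂ = ⊥-elim (next-≢ i (trans l₂ (sym l₁)))
    block-determined {i} _ _ _ _ {σ = 0F} {1F} 1<2 _ _ l₁ _ l₂ = ⊥-elim (next-≢ i (trans l₂ (sym l₁)))
    block-determined {i} _ _ _ _ {σ = 1F} {0F} 1<2 _ _ l₁ _ l₂ = ⊥-elim (next-≢ i (trans l₂ (sym l₁)))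
    block-determined {i' = i'} _ _ _ _ {σ = 2F} {0F} 0<2 _ _ l₁ _ l₂ =
      ⊥-elim (next-next-≢ i' (trans (cong next (sym l₁)) l₂))
    block-determined {i' = i'} _ _ _ _ {σ = 2F} {1F} 0<2 _ _ l₁ _ l₂ =
      ⊥-elim (next-next-≢ i' (trans (cong next (sym l₁)) l₂))
    block-determined {i' = i'} _ _ _ _ {σ = 2F} {0F} 1<2 _ _ l₁ _ l₂ =
      ⊥-elim (next-next-≢ i' (trans (cong next (sym l₁)) l₂))
    block-determined {i' = i'} _ _ _ _ {σ = 2F} {1F} 1<2 _ _ l₁ _ l₂ =
      ⊥-elim (next-next-≢ i' (trans (cong next (sym l₁)) l₂))

    unique-ascending : ∀ {B B' ρ ρ' σ σ'} → Ascending ρ ρ' → σ ≢ σ' →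
                       point B ρ ≡ point B' σ → point B ρ' ≡ point B' σ' → B ≡ B'
    unique-ascending {_ , m , c} {_ , m' , c'} {σ = σ} {σ'} asc σ≢σ' e₁ e₂ =
      block-determined m m' c c' {σ = σ} {σ'} asc σ≢σ' ([]-injective (cong proj₁ e₁)) (cong proj₂ e₁)
                                                        ([]-injective (cong proj₁ e₂)) (cong proj₂ e₂)

  midpoint-GDD : GDD₃ (Fin k) (Fin 3)
  midpoint-GDD = record
    { Block       = Block
    ; finite      = 3 ℕ.* (k ℕ.* h) , ↔-trans *↔× (↔-refl ×-↔ *↔×)
    ; point       = point
    ; transversal = transversal
    ; cover       = cover
    ; unique      = λ {B} {B'} {ρ} {ρ'} {σ} {σ'} →
                      unique-from-ascending point (λ B ρ≢ρ' → transversal B ρ≢ρ' ∘ cong proj₁) unique-ascending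
                        {B} {B'} {ρ} {ρ'} {σ} {σ'}
    }

-- The 3-GDD of type 2^4

module _ where
  open import Data.Product.Properties using (≡-dec)
  open import Data.Vec using (Vec; []; _∷_; lookup)
  open import Relation.Nullary.Decidable using (toWitness; _×-dec_; _→-dec_; ¬?)

  private
    triangles : Vec (Vec (Fin 4 × Fin 2) 3) 8
    triangles = ((0F , 0F) ∷ (1F , 0F) ∷ (2F , 0F) ∷ [])
              ∷ ((0F , 0F) ∷ (1F , 1F) ∷ (3F , 0F) ∷ [])
              ∷ ((0F , 0F) ∷ (2F , 1F) ∷ (3F , 1F) ∷ [])
              ∷ ((0F , 1F) ∷ (1F , 0F) ∷ (3F , 1F) ∷ [])
              ∷ ((0F , 1F) ∷ (1F , 1F) ∷ (2F , 1F) ∷ [])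
              ∷ ((0F , 1F) ∷ (2F , 0F) ∷ (3F , 0F) ∷ [])
              ∷ ((1F , 0F) ∷ (2F , 1F) ∷ (3F , 0F) ∷ [])
              ∷ ((1F , 1F) ∷ (2F , 0F) ∷ (3F , 1F) ∷ [])
              ∷ []

    point : Fin 8 → Fin 3 → Fin 4 × Fin 2
    point B = lookup (lookup triangles B)

    _≟_ : (p q : Fin 4 × Fin 2) → Dec (p ≡ q)
    _≟_ = ≡-dec Fin._≟_ Fin._≟_

    transversal : ∀ B ρ ρ' → ρ ≢ ρ' → proj₁ (point B ρ) ≢ proj₁ (point B ρ')
    transversal = toWitness {a? = Fin.all? λ B → Fin.all? λ ρ → Fin.all? λ ρ' →
      ¬? (ρ Fin.≟ ρ') →-dec ¬? (proj₁ (point B ρ) Fin.≟ proj₁ (point B ρ'))} _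

    cover : ∀ g a g' a' → g ≢ g' →
            Σ (Fin 8) λ B → Σ (Fin 3) λ ρ → Σ (Fin 3) λ ρ' → point B ρ ≡ (g , a) × point B ρ' ≡ (g' , a')
    cover = toWitness {a? = Fin.all? λ g → Fin.all? λ a → Fin.all? λ g' → Fin.all? λ a' →
      ¬? (g Fin.≟ g') →-dec Fin.any? λ B → Fin.any? λ ρ → Fin.any? λ ρ' →
        (point B ρ ≟ (g , a)) ×-dec (point B ρ' ≟ (g' , a'))} _

    unique : ∀ B B' ρ ρ' σ σ' → ρ ≢ ρ' → point B ρ ≡ point B' σ → point B ρ' ≡ point B' σ' → B ≡ B'
    unique = toWitness {a? = Fin.all? λ B → Fin.all? λ B' → Fin.all? λ ρ → Fin.all? λ ρ' → Fin.all? λ σ → Fin.all? λ σ' →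
      ¬? (ρ Fin.≟ ρ') →-dec (point B ρ ≟ point B' σ) →-dec (point B ρ' ≟ point B' σ') →-dec (B Fin.≟ B')} _

  GDD-2⁴ : GDD₃ (Fin 4) (Fin 2)
  GDD-2⁴ = record
    { Block       = Fin 8
    ; finite      = 8 , ↔-refl
    ; point       = point
    ; transversal = λ B → transversal B _ _
    ; cover       = λ (g , a) (g' , a') → cover g a g' a'
    ; unique      = unique _ _ _ _ _ _
    }

-- Opened only now: the residue modules above use the integer operators of the same names.
open import Data.Nat using (_+_; _*_; _<_; _/_; _%_)
open import Data.Nat.Divisibility using (_∣_)
open import Data.Nat.DivMod using (m<n⇒m%n≡m; [m+kn]%n≡m%n)
open ≡-Reasoning

≢⇒K-adj : {a b : Fin n} → a ≢ b → adj (K n) a b ≡ true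
≢⇒K-adj {a = a} {b} a≢b with a Fin.≟ b
... | yes a≡b = ⊥-elim (a≢b a≡b)
... | no  _   = refl

K-adj⇒≢ : {a b : Fin n} → adj (K n) a b ≡ true → a ≢ b
K-adj⇒≢ {a = a} {b} e a≡b with a Fin.≟ b
K-adj⇒≢ () a≡b | yes _
... | no a≢b = a≢b a≡b

adj⇒≢ : (H : Graph) {x y : Fin (V H)} → adj H x y ≡ true → x ≢ y
adj⇒≢ H {x} e refl with () ← trans (sym e) (adj-irrefl H x)

InCopy⇒adj : (c : Copy G H) {a b : Fin (V H)} → InCopy c a b → adj H a b ≡ true
InCopy⇒adj c (x , y , e , refl , refl) = edges c x y e

count : Decomposition H G → ℕ
count = proj₁

copy : (D : Decomposition H G) → Fin (count D) → Copy G H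
copy D = proj₁ (proj₂ D)

covers : (D : Decomposition H G) → ∀ a b → adj H a b ≡ true →
         Σ (Fin (count D)) λ l → InCopy (copy D l) a b
covers D = proj₁ (proj₂ (proj₂ D))

disjoint : (D : Decomposition H G) → ∀ {a b} l l' →
           InCopy (copy D l) a b → InCopy (copy D l') a b → l ≡ l'
disjoint D l l' = proj₂ (proj₂ (proj₂ D)) _ _ l l'

Copy-embed : (f : Fin (V H) → Fin n) → Injective _≡_ _≡_ f → Copy G H → Copy G (K n)
Copy-embed {G = G} f f-inj c = record
  { vmap      = f ∘ vmap c
  ; injective = injective c ∘ f-inj
  ; edges     = λ x y e → ≢⇒K-adj (adj⇒≢ G e ∘ injective c ∘ f-inj)
  }

InCopy-embed : ∀ {f} (f-inj : Injective _≡_ _≡_ f) (c : Copy G H) {a b} →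
               InCopy c a b → InCopy (Copy-embed {n = n} f f-inj c) (f a) (f b)
InCopy-embed _ _ (x , y , e , refl , refl) = x , y , e , refl , refl

InCopy-embed⁻¹ : ∀ {f} (f-inj : Injective _≡_ _≡_ f) (c : Copy G H) {a b} →
                 InCopy (Copy-embed {n = n} f f-inj c) a b →
                 Σ (Fin (V H)) λ x → Σ (Fin (V H)) λ y → f x ≡ a × f y ≡ b × InCopy c x y
InCopy-embed⁻¹ _ c (x , y , e , refl , refl) = vmap c x , vmap c y , refl , refl , x , y , e , refl , refl

record Piece (G : Graph) (X : Set) : Set where
  field
    host            : Graph
    decomposition   : Decomposition host G
    embed           : Fin (V host) → X
    embed-injective : Injective _≡_ _≡_ embed
open Piece

EdgeOf : Piece G X → X → X → Set
EdgeOf P a b = Σ (Fin (V (host P))) λ x → Σ (Fin (V (host P))) λ y →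
  adj (host P) x y ≡ true × embed P x ≡ a × embed P y ≡ b

module _ {m : ℕ} (X↔ : Fin n ↔ X) (P : Fin m → Piece G X)
  (cover  : ∀ {a b} → a ≢ b → Σ (Fin m) λ j → EdgeOf (P j) a b)
  (unique : ∀ {a b} j j' → EdgeOf (P j) a b → EdgeOf (P j') a b → j ≡ j')
  where
  open Inverse X↔ using (to; from; strictlyInverseˡ; strictlyInverseʳ)

  private
    size : Fin m → ℕ
    size j = count (decomposition (P j))

    Σ↔ : Fin (∑ m size) ↔ Σ (Fin m) (Fin ∘ size)
    Σ↔ = Σ-Fin↔ m size

    φ : (j : Fin m) → Fin (V (host (P j))) → Fin n
    φ j = from ∘ embed (P j)

    φ-injective : ∀ j → Injective _≡_ _≡_ (φ j)
    φ-injective j = embed-injective (P j) ∘ ↔-from-injective X↔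

    image : Σ (Fin m) (Fin ∘ size) → Copy G (K n)
    image (j , l) = Copy-embed (φ j) (φ-injective j) (copy (decomposition (P j)) l)

    image-covers : ∀ a b → adj (K n) a b ≡ true → Σ (Σ (Fin m) (Fin ∘ size)) λ s → InCopy (image s) a b
    image-covers a b e with j , x , y , exy , ex , ey ← cover (K-adj⇒≢ e ∘ ↔-to-injective X↔)
      with l , inCopy ← covers (decomposition (P j)) x y exy
      = (j , l) , subst₂ (InCopy (image (j , l))) (φ≡ ex) (φ≡ ey)
                         (InCopy-embed (φ-injective j) (copy (decomposition (P j)) l) inCopy)
      where
      φ≡ : ∀ {x c} → embed (P j) x ≡ to c → φ j x ≡ c
      φ≡ {c = c} ex = trans (cong from ex) (strictlyInverseʳ c)

    edgeOf : ∀ j {x y a b} → adj (host (P j)) x y ≡ true → φ j x ≡ a → φ j y ≡ b →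
             EdgeOf (P j) (to a) (to b)
    edgeOf j {x} {y} exy φx φy = x , y , exy , ≡to (embed (P j) x) φx , ≡to (embed (P j) y) φy
      where
      ≡to : ∀ u {c} → from u ≡ c → u ≡ to c
      ≡to u p = trans (sym (strictlyInverseˡ u)) (cong to p)

    image-disjoint : ∀ {a b} s s' → InCopy (image s) a b → InCopy (image s') a b → s ≡ s'
    image-disjoint (j , l) (j' , l') c c'
      with x , y , φx , φy , inCopy ← InCopy-embed⁻¹ (φ-injective j) (copy (decomposition (P j)) l) c
         | x' , y' , φx' , φy' , inCopy' ← InCopy-embed⁻¹ (φ-injective j') (copy (decomposition (P j')) l') c'
      with refl ← unique j j' (edgeOf j (InCopy⇒adj (copy (decomposition (P j)) l) inCopy) φx φy)
                              (edgeOf j' (InCopy⇒adj (copy (decomposition (P j')) l') inCopy') φx' φy')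
      with refl ← φ-injective j {x} {x'} (trans φx (sym φx'))
         | refl ← φ-injective j {y} {y'} (trans φy (sym φy'))
      = cong (j ,_) (disjoint (decomposition (P j)) l l' inCopy inCopy')

  glue-Fin : Design G n
  glue-Fin = ∑ m size , image ∘ Inverse.to Σ↔ , covers′ , disjoint′
    where
    covers′ : ∀ a b → adj (K n) a b ≡ true → Σ (Fin (∑ m size)) λ k → InCopy (image (Inverse.to Σ↔ k)) a b
    covers′ a b e with s , inCopy ← image-covers a b e =
      Inverse.from Σ↔ s , subst (λ s → InCopy (image s) a b) (sym (Inverse.strictlyInverseˡ Σ↔ s)) inCopy
    disjoint′ : ∀ a b k k' →
                InCopy (image (Inverse.to Σ↔ k)) a b → InCopy (image (Inverse.to Σ↔ k')) a b → k ≡ k'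
    disjoint′ a b k k' c c' = ↔-to-injective Σ↔ (image-disjoint _ _ c c')

glue : Fin n ↔ X → Finite I → (P : I → Piece G X) →
  (∀ {a b} → a ≢ b → Σ I λ i → EdgeOf (P i) a b) →
  (∀ {a b} i i' → EdgeOf (P i) a b → EdgeOf (P i') a b → i ≡ i') →
  Design G n
glue X↔ (m , I↔) P cover unique = glue-Fin X↔ (P ∘ to) cover′ λ j j' e e' → ↔-to-injective I↔ (unique _ _ e e')
  where
  open Inverse I↔ using (to; from; strictlyInverseˡ)
  cover′ : ∀ {a b} → a ≢ b → Σ (Fin m) λ j → EdgeOf (P (to j)) a b
  cover′ a≢b with i , edge ← cover a≢b = from i , subst (λ i → EdgeOf (P i) _ _) (sym (strictlyInverseˡ i)) edge

tripartite↔ : ∀ t → Fin (3 * t) ↔ (Fin 3 × Fin t)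
tripartite↔ t = ↔-trans cast↔ (↔-trans *↔× (×-comm _ _))
  where
  eq : 3 * t ≡ t * 3
  eq = ℕ.*-comm 3 t
  cast↔ : Fin (3 * t) ↔ Fin (t * 3)
  cast↔ = mk↔ₛ′ (cast eq) (cast (sym eq)) (Fin.cast-involutive eq (sym eq)) (Fin.cast-involutive (sym eq) eq)

module TripartiteCoordinates (t : ℕ) where

  part : Fin (3 * t) → Fin 3
  part = proj₁ ∘ Inverse.to (tripartite↔ t)

  toℕ-part : (x : Fin (3 * t)) → toℕ (part x) ≡ toℕ x % 3
  toℕ-part x = begin
    toℕ r                     ≡⟨ m<n⇒m%n≡m (Fin.toℕ<n r) ⟨
    toℕ r % 3                 ≡⟨ [m+kn]%n≡m%n (toℕ r) (toℕ q) 3 ⟨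
    (toℕ r + toℕ q * 3) % 3   ≡⟨ cong (_% 3) toℕ-x ⟩
    toℕ x % 3                 ∎
    where
    x′ : Fin (t * 3)
    x′ = cast (ℕ.*-comm 3 t) x
    q : Fin t
    q = proj₁ (remQuot {t} 3 x′)
    r : Fin 3
    r = proj₂ (remQuot {t} 3 x′)
    toℕ-x : toℕ r + toℕ q * 3 ≡ toℕ x
    toℕ-x = begin
      toℕ r + toℕ q * 3        ≡⟨ trans (ℕ.+-comm (toℕ r) _) (cong (_+ toℕ r) (ℕ.*-comm (toℕ q) 3)) ⟩
      3 * toℕ q + toℕ r        ≡⟨ Fin.toℕ-combine q r ⟨
      toℕ (combine q r)        ≡⟨ cong toℕ (Fin.combine-remQuot {t} 3 x′) ⟩
      toℕ x′                   ≡⟨ Fin.toℕ-cast _ x ⟩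
      toℕ x                    ∎

  Tripartite-adj⇒ : ∀ {x y : Fin (3 * t)} → adj (Tripartite t) x y ≡ true → part x ≢ part y
  Tripartite-adj⇒ {x = x} {y} e p with toℕ x % 3 ℕ.≟ toℕ y % 3
  Tripartite-adj⇒ () p | yes _
  ... | no ne = ne (trans (sym (toℕ-part x)) (trans (cong toℕ p) (toℕ-part y)))

  Tripartite-adj⇐ : ∀ {x y : Fin (3 * t)} → part x ≢ part y → adj (Tripartite t) x y ≡ true
  Tripartite-adj⇐ {x = x} {y} ne with toℕ x % 3 ℕ.≟ toℕ y % 3
  ... | yes p = ⊥-elim (ne (Fin.toℕ-injective (trans (toℕ-part x) (trans p (sym (toℕ-part y))))))
  ... | no _  = refl

module _ {R S : Set} {r s t : ℕ} (R↔ : Fin r ↔ R) (S↔ : Fin s ↔ S) (𝓓 : GDD₃ R S)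
         (tripartite : Decomposition (Tripartite t) G) (filling : Design G (1 + s * t)) where
  open GDD₃ 𝓓
  open TripartiteCoordinates t

  private
    -- inj₁ tt is the point ∞.
    Fibre : Set
    Fibre = ⊤ ⊎ (S × Fin t)
    Point : Set
    Point = ⊤ ⊎ (R × (S × Fin t))

    Fibre↔ : Fin (1 + s * t) ↔ Fibre
    Fibre↔ = ↔-trans +↔⊎ (1↔⊤ ⊎-↔ ↔-trans *↔× (S↔ ×-↔ ↔-refl))

    Point↔ : Fin (1 + r * (s * t)) ↔ Point
    Point↔ = ↔-trans +↔⊎ (1↔⊤ ⊎-↔ ↔-trans *↔× (R↔ ×-↔ ↔-trans *↔× (S↔ ×-↔ ↔-refl)))

    into : R → Fibre → Point
    into g (inj₁ tt) = inj₁ tt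
    into g (inj₂ q)  = inj₂ (g , q)

    into-injective : ∀ g → Injective _≡_ _≡_ (into g)
    into-injective g {inj₁ tt} {inj₁ tt} _    = refl
    into-injective g {inj₂ _}  {inj₂ _}  refl = refl

    block-point : Block → Fin 3 × Fin t → Point
    block-point B = inj₂ ∘ inflate B

    block-point-injective : ∀ B → Injective _≡_ _≡_ (block-point B)
    block-point-injective B e with eρ , ei ← inflate-injective (inj₂-injective e) =
      cong₂ _,_ (point-injective B eρ) ei

    group-piece : R → Piece G Point
    group-piece g = record
      { host            = K (1 + s * t)
      ; decomposition   = filling
      ; embed           = into g ∘ Inverse.to Fibre↔
      ; embed-injective = ↔-to-injective Fibre↔ ∘ into-injective g
      }

    block-piece : Block → Piece G Point
    block-piece B = record
      { host            = Tripartite t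
      ; decomposition   = tripartite
      ; embed           = block-point B ∘ Inverse.to (tripartite↔ t)
      ; embed-injective = ↔-to-injective (tripartite↔ t) ∘ block-point-injective B
      }

    piece : R ⊎ Block → Piece G Point
    piece = [ group-piece , block-piece ]

    group-edge : ∀ g {u v} → u ≢ v → EdgeOf (group-piece g) (into g u) (into g v)
    group-edge g {u} {v} u≢v =
      from u , from v , ≢⇒K-adj (u≢v ∘ ↔-from-injective Fibre↔) ,
      cong (into g) (strictlyInverseˡ u) , cong (into g) (strictlyInverseˡ v)
      where open Inverse Fibre↔

    group-edge⁻¹ : ∀ {g a b} → EdgeOf (group-piece g) a b →
                  Σ Fibre λ u → Σ Fibre λ v → u ≢ v × into g u ≡ a × into g v ≡ b
    group-edge⁻¹ (x , y , e , refl , refl) = _ , _ , K-adj⇒≢ e ∘ ↔-to-injective Fibre↔ , refl , refl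

    block-edge : ∀ B {p q} → proj₁ p ≢ proj₁ q → EdgeOf (block-piece B) (block-point B p) (block-point B q)
    block-edge B {p} {q} p≢q =
      from p , from q , Tripartite-adj⇐ (λ e → p≢q (trans (sym (part-from p)) (trans e (part-from q)))) ,
      cong (block-point B) (strictlyInverseˡ p) , cong (block-point B) (strictlyInverseˡ q)
      where
      open Inverse (tripartite↔ t)
      part-from : ∀ p → part (from p) ≡ proj₁ p
      part-from p = cong proj₁ (strictlyInverseˡ p)

    block-edge⁻¹ : ∀ {B a b} → EdgeOf (block-piece B) a b →
                  Σ (Fin 3 × Fin t) λ p → Σ (Fin 3 × Fin t) λ q →
                    proj₁ p ≢ proj₁ q × block-point B p ≡ a × block-point B q ≡ b
    block-edge⁻¹ (x , y , e , refl , refl) = _ , _ , Tripartite-adj⇒ e , refl , refl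

    _≟ᴿ_ : (g g' : R) → Dec (g ≡ g')
    _≟ᴿ_ = Fin.inj⇒≟ (↔⇒↣ (↔-sym R↔))

    pieces-cover : ∀ {a b} → a ≢ b → Σ (R ⊎ Block) λ i → EdgeOf (piece i) a b
    pieces-cover {inj₁ tt} {inj₁ tt} a≢b = ⊥-elim (a≢b refl)
    pieces-cover {inj₁ tt} {inj₂ (g , q)} _ = inj₁ g , group-edge g {inj₁ tt} {inj₂ q} λ ()
    pieces-cover {inj₂ (g , q)} {inj₁ tt} _ = inj₁ g , group-edge g {inj₂ q} {inj₁ tt} λ ()
    pieces-cover {inj₂ (g , q)} {inj₂ (g' , q')} a≢b with g ≟ᴿ g'
    ... | yes refl = inj₁ g , group-edge g (a≢b ∘ cong (into g))
    ... | no g≢g'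
      with (a , i) ← q | (a' , i') ← q'
      with B , ρ , ρ' , eρ , eρ' ← cover (g , a) (g' , a') g≢g'
      = inj₂ B , subst₂ (EdgeOf (block-piece B)) (cong (inj₂ ∘ map₂ (_, i)) eρ) (cong (inj₂ ∘ map₂ (_, i')) eρ')
                        (block-edge B {ρ , i} {ρ' , i'} λ { refl → g≢g' (cong proj₁ (trans (sym eρ) eρ')) })

    fibres-meet : ∀ {g g' u u' v v'} → u ≢ v → into g u ≡ into g' u' → into g v ≡ into g' v' → g ≡ g'
    fibres-meet {u = inj₂ _} {inj₂ _} _ refl _ = refl
    fibres-meet {v = inj₂ _} {inj₂ _} _ _ refl = refl
    fibres-meet {u = inj₁ tt} {inj₁ tt} {inj₁ tt} {inj₁ tt} u≢v _ _ = ⊥-elim (u≢v refl)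
    fibres-meet {u = inj₁ tt} {inj₂ _} _ () _
    fibres-meet {u = inj₂ _} {inj₁ tt} _ () _
    fibres-meet {v = inj₁ tt} {inj₂ _} _ _ ()
    fibres-meet {v = inj₂ _} {inj₁ tt} _ _ ()

    fibre-group : ∀ {g u B p} → into g u ≡ block-point B p → proj₁ (point B (proj₁ p)) ≡ g
    fibre-group {u = inj₂ _} refl = refl

    pieces-disjoint : ∀ {a b} i i' → EdgeOf (piece i) a b → EdgeOf (piece i') a b → i ≡ i'
    pieces-disjoint (inj₁ g) (inj₁ g') e e'
      with u , v , u≢v , refl , refl ← group-edge⁻¹ e | _ , _ , _ , eu , ev ← group-edge⁻¹ e'
      = cong inj₁ (fibres-meet u≢v (sym eu) (sym ev))
    pieces-disjoint (inj₁ g) (inj₂ B) e e'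
      with _ , _ , _ , eu , ev ← group-edge⁻¹ e | _ , _ , p≢q , refl , refl ← block-edge⁻¹ e'
      = ⊥-elim (transversal B p≢q (trans (fibre-group eu) (sym (fibre-group ev))))
    pieces-disjoint (inj₂ B) (inj₁ g) e e'
      with _ , _ , p≢q , refl , refl ← block-edge⁻¹ e | _ , _ , _ , eu , ev ← group-edge⁻¹ e'
      = ⊥-elim (transversal B p≢q (trans (fibre-group eu) (sym (fibre-group ev))))
    pieces-disjoint (inj₂ B) (inj₂ B') e e'
      with _ , _ , p≢q , refl , refl ← block-edge⁻¹ e | _ , _ , _ , ep , eq ← block-edge⁻¹ e'
      = cong inj₂ (unique p≢q (sym (proj₁ (inflate-injective (inj₂-injective ep))))
                               (sym (proj₁ (inflate-injective (inj₂-injective eq)))))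

  design-from-GDD₃ : Design G (1 + r * (s * t))
  design-from-GDD₃ = glue Point↔ (_ , ↔-trans +↔⊎ (R↔ ⊎-↔ proj₂ finite)) piece pieces-cover pieces-disjoint

design-of-order-1 : Design G 1
design-of-order-1 = 0 , (λ ()) , (λ { 0F 0F () }) , λ _ _ ()

module _ {t : ℕ} (tripartite : Decomposition (Tripartite t) G)
         (design₆ : Design G (1 + 6 * t)) (design₁₂ : Design G (1 + 12 * t)) where
  open import Data.Nat.DivMod using (_divMod_; result)
  open import Data.Nat.Induction using (<-rec)
  open import Data.Nat.Tactic.RingSolver using (solve-∀)

  private
    design-via : ∀ {r a b N} → GDD₃ (Fin r) (Fin a × Fin b) → Design G (1 + (a * b) * t) →
          1 + r * ((a * b) * t) ≡ N → Design G N
    design-via 𝓓 filling eq = subst (Design G) eq (design-from-GDD₃ ↔-refl *↔× 𝓓 tripartite filling)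

  design-1+6tk : ∀ k → Design G (1 + k * (6 * t))
  design-1+6tk = <-rec _ step
    where
    step : ∀ k → (∀ {j} → j < k → Design G (1 + j * (6 * t))) → Design G (1 + k * (6 * t))
    step k rec with k divMod 4
    ... | result zero    0F refl = design-of-order-1
    ... | result (suc p) 0F refl =
      design-via (GDD-2⁴ ⊗ cyclic-TD (3 * suc p))
          (subst (Design G) (cong suc (lemma′ p t)) (rec (ℕ.m<m*n (suc p) 4 (ℕ.s≤s (ℕ.s≤s ℕ.z≤n)))))
          (cong suc (lemma p t))
      where
      lemma : ∀ p t → 4 * ((2 * (3 * suc p)) * t) ≡ (0 + suc p * 4) * (6 * t)
      lemma = solve-∀
      lemma′ : ∀ p t → suc p * (6 * t) ≡ (2 * (3 * suc p)) * t
      lemma′ = solve-∀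
    ... | result q 1F refl = design-via (midpoint-GDD (q + q) ⊗ cyclic-TD 2) design₆ (cong suc (lemma q t))
      where
      lemma : ∀ q t → suc ((q + q) + (q + q)) * (6 * t) ≡ (1 + q * 4) * (6 * t)
      lemma = solve-∀
    ... | result q 2F refl = design-via (midpoint-GDD q ⊗ cyclic-TD 4) design₁₂ (cong suc (lemma q t))
      where
      lemma : ∀ q t → suc (q + q) * (12 * t) ≡ (2 + q * 4) * (6 * t)
      lemma = solve-∀
    ... | result q 3F refl = design-via (midpoint-GDD (suc (q + q)) ⊗ cyclic-TD 2) design₆ (cong suc (lemma q t))
      where
      lemma : ∀ q t → suc (suc (q + q) + suc (q + q)) * (6 * t) ≡ (3 + q * 4) * (6 * t)
      lemma = solve-∀

proposition2 : (G : Graph) (e : ℕ) → edgeCount G ≡ e → 0 < e → 3 ∣ e →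
    Design G (2 * e + 1) → Design G (4 * e + 1) →
    Decomposition (Tripartite (e / 3)) G →
    ∀ n k → n ≡ k * (2 * e) + 1 → Design G n
proposition2 G e _ _ 3∣e design₂ₑ design₄ₑ tripartite n k refl =
  subst (Design G) (sym order₂ₖ)
    (design-1+6tk tripartite (subst (Design G) order₂ design₂ₑ) (subst (Design G) order₄ design₄ₑ) k)
  where
  open import Data.Nat.DivMod using (m*[n/m]≡n)
  open import Data.Nat.Tactic.RingSolver using (solve-∀)
  t : ℕ
  t = e / 3
  e≡3t : e ≡ 3 * t
  e≡3t = sym (m*[n/m]≡n 3∣e)
  order₂ : 2 * e + 1 ≡ 1 + 6 * t
  order₂ = trans (cong (λ e → 2 * e + 1) e≡3t) (lemma t)
    where lemma : ∀ t → 2 * (3 * t) + 1 ≡ 1 + 6 * t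
          lemma = solve-∀
  order₄ : 4 * e + 1 ≡ 1 + 12 * t
  order₄ = trans (cong (λ e → 4 * e + 1) e≡3t) (lemma t)
    where lemma : ∀ t → 4 * (3 * t) + 1 ≡ 1 + 12 * t
          lemma = solve-∀
  order₂ₖ : k * (2 * e) + 1 ≡ 1 + k * (6 * t)
  order₂ₖ = trans (cong (λ e → k * (2 * e) + 1) e≡3t) (lemma k t)
    where lemma : ∀ k t → k * (2 * (3 * t)) + 1 ≡ 1 + k * (6 * t)
          lemma = solve-∀
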